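{- Let $G$ be a finite simple graph. Then: (a) if $\mathrm{h}(G)=k$, there exists a (possibly empty) sequence of vertex identifications, starting from $G$, such that at each step the two identified vertices are at distance at least $3$ in the current graph, and the graph $H$ obtained at the end has exactly $k$ vertices and diameter at most $2$; and (b) if $H$ is obtained from $G$ by a sequence of vertex identifications such that at each step the two identified vertices are at distance at least $3$ in the current graph, then $\mathrm{h}(G)\le\mathrm{h}(H)$.
   Context: $\operatorname{dist}_G(u,v)$ is the length of a shortest $u$–$v$ path in $G$ ($+\infty$ if none exists), and the diameter of $G$ is the maximum distance between two of its vertices. For two distinct non-adjacent vertices $u,v$ of a graph $G$, identifying $u$ and $v$ produces the simple graph $G\circ uv$ obtained by deleting $u$ and $v$, adding a new vertex $w$, and joining $w$ to every vertex adjacent to $u$ or to $v$ (without multiple edges). A $k$-coloring $c:V(G)\to\{1,\dots,k\}$ is harmonious if it is proper ($c(x)\ne c(y)$ for every edge $xy$) and for every pair of distinct edges $xy,zt$ we have $\{c(x),c(y)\}\neq\{c(z),c(t)\}$. The harmonious chromatic number $\mathrm{h}(G)$ is the least $k$ such that $G$ has a harmonious $k$-coloring. -}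

module Defs where

open import Data.Nat using (ℕ; zero; suc; _≤_; _<_)
open import Data.Fin using (Fin)
open import Data.Bool using (Bool; true)
open import Data.Product using (Σ; ∃; ∃-syntax; _×_; _,_)
open import Data.Sum using (_⊎_)
open import Relation.Nullary using (¬_)
open import Relation.Binary.PropositionalEquality using (_≡_; _≢_)

record Graph : Set where
  field
    n      : ℕ
    adj    : Fin n → Fin n → Bool
    sym    : ∀ x y → adj x y ≡ adj y x
    irrefl : ∀ x → ¬ (adj x x ≡ true)

open Graph public

V : Graph → Set
V G = Fin (n G)

Edge : (G : Graph) → V G → V G → Set
Edge G x y = adj G x y ≡ true

SamePair : {A : Set} → A → A → A → A → Set
SamePair x y z t = (x ≡ z × y ≡ t) ⊎ (x ≡ t × y ≡ z)

data Walk (G : Graph) : ℕ → V G → V G → Set where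
  here : ∀ {x} → Walk G zero x x
  step : ∀ {l x y z} → Edge G x y → Walk G l y z → Walk G (suc l) x z

-- dist_G(u,v) ≥ d  (including dist = +∞): no u–v walk of length < d
DistAtLeast : (G : Graph) → V G → V G → ℕ → Set
DistAtLeast G u v d = ∀ l → l < d → ¬ Walk G l u v

DiamAtMost : Graph → ℕ → Set
DiamAtMost G d = ∀ u v → ∃[ l ] (l ≤ d × Walk G l u v)

-- H ≅ G ∘ uv  (identification of distinct non-adjacent u, v), described by the
-- quotient map f : V(G) → V(H) that sends u and v to the new vertex w and is a
-- bijection from V(G) ∖ {u,v} onto V(H) ∖ {w}; edges of H are exactly images of edges of G.
record IsIdentification (G H : Graph) (u v : V G) : Set where
  field
    distinct    : u ≢ v
    nonadjacent : ¬ Edge G u v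
    f           : V G → V H
    surj        : ∀ a → ∃[ x ] (f x ≡ a)
    glue        : f u ≡ f v
    onlyGlue    : ∀ x y → f x ≡ f y → x ≡ y ⊎ SamePair x y u v
    edgesFrom   : ∀ x y → Edge G x y → Edge H (f x) (f y)
    edgesTo     : ∀ a b → Edge H a b → ∃[ x ] ∃[ y ] (f x ≡ a × f y ≡ b × Edge G x y)

data Step3 (G H : Graph) : Set where
  ident : (u v : V G) → DistAtLeast G u v 3 → IsIdentification G H u v → Step3 G H

data Steps3 : Graph → Graph → Set where
  done : ∀ {G} → Steps3 G G
  _∷_  : ∀ {G H K} → Step3 G H → Steps3 H K → Steps3 G K

IsHarmonious : (G : Graph) (k : ℕ) → (V G → Fin k) → Set
IsHarmonious G k c =
  (∀ x y → Edge G x y → c x ≢ c y) ×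
  (∀ x y z t → Edge G x y → Edge G z t →
     SamePair (c x) (c y) (c z) (c t) → SamePair x y z t)

HasHarmonious : Graph → ℕ → Set
HasHarmonious G k = Σ (V G → Fin k) (IsHarmonious G k)

IsHarmNum : Graph → ℕ → Set
IsHarmNum G k = HasHarmonious G k × (∀ j → HasHarmonious G j → k ≤ j)

{-# OPTIONS --safe #-}
module Submission where

-- The quotient map of an identification of two vertices at distance ≥ 3 is
-- injective on edges (an edge meeting both glued vertices would give a path of
-- length ≤ 2 between them), so harmonious colourings pull back along it, which
-- gives (b).  Conversely a harmonious colouring forces equally coloured
-- vertices to be at distance ≥ 3, and it descends to the graph in which two of
-- them are identified.  Hence, starting from an optimal colouring, while there
-- are fewer colours than vertices we may identify two equally coloured vertices
-- without changing h (the colouring descends, and (b) bounds h from the other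
-- side).  Once h equals the number of vertices, two vertices at distance ≥ 3
-- cannot exist: identifying them would give a harmonious colouring of G with
-- one colour fewer.

open import Defs
open import Data.Nat using (ℕ; _≤_)
open import Data.Product using (_×_; ∃-syntax)
open import Relation.Binary.PropositionalEquality using (_≡_)

open import Data.Nat using (zero; suc; pred; _<_; z≤n; s≤s)
open import Data.Nat.Induction using (<-wellFounded)
open import Data.Nat.Properties using (≤-refl; <⇒≱; m≤n⇒m<n∨m≡n)
open import Data.Fin using (Fin; punchIn; punchOut)
open import Data.Fin.Properties
  using (_≟_; any?; pigeonhole; <⇒≢; punchOut-cong; punchOut-injective; punchOut-punchIn; punchInᵢ≢i)
open import Data.Bool using (true)
import Data.Bool.Properties as Bool
open import Data.Product using (_,_; proj₁)
open import Data.Sum using (_⊎_; inj₁; inj₂)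
open import Data.Empty using (⊥-elim)
open import Function using (_∘_; id)
open import Function.Bundles using (mk⇔)
open import Induction.WellFounded using (Acc; acc)
open import Relation.Nullary using (¬_; Dec; yes; no; does; contradiction)
open import Relation.Nullary.Decidable using (dec-true; does-⇔; _×-dec_)
open import Relation.Binary.PropositionalEquality
  using (_≢_; refl; trans; subst; ≢-sym) renaming (sym to ≡-sym)

Edge-sym : ∀ G {x y} → Edge G x y → Edge G y x
Edge-sym G {x} {y} e = trans (Graph.sym G y x) e

SamePair-map : ∀ {A B : Set} (g : A → B) {x y z t} →
               SamePair x y z t → SamePair (g x) (g y) (g z) (g t)
SamePair-map g (inj₁ (refl , refl)) = inj₁ (refl , refl)
SamePair-map g (inj₂ (refl , refl)) = inj₂ (refl , refl)

SamePair-subst : ∀ {A : Set} {a b c d a′ b′ c′ d′ : A} →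
                 a ≡ a′ → b ≡ b′ → c ≡ c′ → d ≡ d′ → SamePair a b c d → SamePair a′ b′ c′ d′
SamePair-subst refl refl refl refl s = s

witness : ∀ {P : Set} (P? : Dec P) → does P? ≡ true → P
witness (yes p) _  = p
witness (no _)  ()

pred<size : ∀ {N} → Fin N → pred N < N
pred<size {suc _} _ = ≤-refl

module _ {G : Graph} {u v : V G} where

  distAtLeast3 : u ≢ v → ¬ Edge G u v → (∀ {x} → Edge G u x → ¬ Edge G x v) →
                 DistAtLeast G u v 3
  distAtLeast3 u≢v _   _        zero             _  here                     = u≢v refl
  distAtLeast3 _   ¬uv _        (suc zero)       _  (step e here)            = ¬uv e
  distAtLeast3 _   _   noCommon (suc (suc zero)) _  (step e₁ (step e₂ here)) = noCommon e₁ e₂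
  distAtLeast3 _   _   _        (suc (suc (suc _))) (s≤s (s≤s (s≤s ()))) _

  distAtLeast3⇒distinct : DistAtLeast G u v 3 → u ≢ v
  distAtLeast3⇒distinct far refl = far 0 (s≤s z≤n) here

  distAtLeast3⇒nonadjacent : DistAtLeast G u v 3 → ¬ Edge G u v
  distAtLeast3⇒nonadjacent far e = far 1 (s≤s (s≤s z≤n)) (step e here)

  distAtLeast3⇒noCommonNeighbour : DistAtLeast G u v 3 → ∀ {x} → Edge G u x → ¬ Edge G x v
  distAtLeast3⇒noCommonNeighbour far e₁ e₂ = far 2 ≤-refl (step e₁ (step e₂ here))

walk≤2⊎distAtLeast3 : ∀ G u v → (∃[ l ] (l ≤ 2 × Walk G l u v)) ⊎ DistAtLeast G u v 3
walk≤2⊎distAtLeast3 G u v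
  with u ≟ v | adj G u v Bool.≟ true
     | any? (λ x → (adj G u x Bool.≟ true) ×-dec (adj G x v Bool.≟ true))
... | yes refl | _      | _                  = inj₁ (0 , z≤n , here)
... | no _     | yes e  | _                  = inj₁ (1 , s≤s z≤n , step e here)
... | no _     | no _   | yes (x , e₁ , e₂)  = inj₁ (2 , ≤-refl , step e₁ (step e₂ here))
... | no u≢v   | no ¬uv | no noPath          =
  inj₂ (distAtLeast3 u≢v ¬uv (λ e₁ e₂ → noPath (_ , e₁ , e₂)))

sameColour⇒distAtLeast3 : ∀ {G k c} → IsHarmonious G k c → ∀ {u v} → u ≢ v → c u ≡ c v →
                          DistAtLeast G u v 3
sameColour⇒distAtLeast3 {G} (proper , harmonious) {u} {v} u≢v cu≡cv =
  distAtLeast3 u≢v (λ e → proper u v e cu≡cv) noCommon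
  where
  noCommon : ∀ {x} → Edge G u x → ¬ Edge G x v
  noCommon {x} e₁ e₂ with harmonious x u x v (Edge-sym G e₁) e₂ (inj₁ (refl , cu≡cv))
  ... | inj₁ (_ , u≡v)   = u≢v u≡v
  ... | inj₂ (x≡v , u≡x) = u≢v (trans u≡x x≡v)

id-harmonious : ∀ G → IsHarmonious G (n G) id
id-harmonious G = (λ x y e x≡y → irrefl G x (subst (Edge G x) (≡-sym x≡y) e)) ,
                  (λ _ _ _ _ _ _ same → same)

harmNum≤size : ∀ {G k} → IsHarmNum G k → k ≤ n G
harmNum≤size {G} (_ , minimal) = minimal (n G) (id , id-harmonious G)

module _ {G H : Graph} {u v : V G} (far : DistAtLeast G u v 3) (I : IsIdentification G H u v) where
  open IsIdentification I

  identification-injectiveOnEdges : ∀ {x y z t} → Edge G x y → Edge G z t →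
                                    f x ≡ f z → f y ≡ f t → x ≡ z × y ≡ t
  identification-injectiveOnEdges {x} {y} {z} {t} exy ezt fx≡fz fy≡ft
    with onlyGlue x z fx≡fz | onlyGlue y t fy≡ft
  ... | inj₁ x≡z | inj₁ y≡t = x≡z , y≡t
  ... | inj₁ refl | inj₂ (inj₁ (refl , refl)) =
    ⊥-elim (distAtLeast3⇒noCommonNeighbour far (Edge-sym G exy) ezt)
  ... | inj₁ refl | inj₂ (inj₂ (refl , refl)) =
    ⊥-elim (distAtLeast3⇒noCommonNeighbour far (Edge-sym G ezt) exy)
  ... | inj₂ (inj₁ (refl , refl)) | inj₁ refl =
    ⊥-elim (distAtLeast3⇒noCommonNeighbour far exy (Edge-sym G ezt))
  ... | inj₂ (inj₂ (refl , refl)) | inj₁ refl =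
    ⊥-elim (distAtLeast3⇒noCommonNeighbour far ezt (Edge-sym G exy))
  ... | inj₂ (inj₁ (refl , refl)) | inj₂ (inj₁ (refl , refl)) = ⊥-elim (irrefl G u exy)
  ... | inj₂ (inj₁ (refl , refl)) | inj₂ (inj₂ (refl , refl)) = ⊥-elim (nonadjacent exy)
  ... | inj₂ (inj₂ (refl , refl)) | inj₂ (inj₁ (refl , refl)) = ⊥-elim (nonadjacent (Edge-sym G exy))
  ... | inj₂ (inj₂ (refl , refl)) | inj₂ (inj₂ (refl , refl)) = ⊥-elim (irrefl G v exy)

  pullback-harmonious : ∀ {k c} → IsHarmonious H k c → IsHarmonious G k (c ∘ f)
  pullback-harmonious {k} {c} (proper , harmonious) = proper′ , harmonious′
    where
    proper′ : ∀ x y → Edge G x y → c (f x) ≢ c (f y)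
    proper′ x y e = proper (f x) (f y) (edgesFrom x y e)

    harmonious′ : ∀ x y z t → Edge G x y → Edge G z t →
                  SamePair (c (f x)) (c (f y)) (c (f z)) (c (f t)) → SamePair x y z t
    harmonious′ x y z t exy ezt same
      with harmonious (f x) (f y) (f z) (f t) (edgesFrom x y exy) (edgesFrom z t ezt) same
    ... | inj₁ (fx≡fz , fy≡ft) =
      inj₁ (identification-injectiveOnEdges exy ezt fx≡fz fy≡ft)
    ... | inj₂ (fx≡ft , fy≡fz) =
      inj₂ (identification-injectiveOnEdges exy (Edge-sym G ezt) fx≡ft fy≡fz)

Step3-pullback : ∀ {G H k} → Step3 G H → HasHarmonious H k → HasHarmonious G k
Step3-pullback (ident u v far I) (c , hc) = c ∘ IsIdentification.f I , pullback-harmonious far I hc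

Steps3-pullback : ∀ {G H k} → Steps3 G H → HasHarmonious H k → HasHarmonious G k
Steps3-pullback done        = id
Steps3-pullback (s ∷ steps) = Step3-pullback s ∘ Steps3-pullback steps

module _ {G H : Graph} {u v : V G} (I : IsIdentification G H u v) {k : ℕ} (c : V G → Fin k) where
  open IsIdentification I

  descend : V H → Fin k
  descend a = c (proj₁ (surj a))

  descend-∘-f : c u ≡ c v → ∀ x → descend (f x) ≡ c x
  descend-∘-f cu≡cv x with surj (f x)
  ... | y , fy≡fx with onlyGlue y x fy≡fx
  ...   | inj₁ refl                 = refl
  ...   | inj₂ (inj₁ (refl , refl)) = cu≡cv
  ...   | inj₂ (inj₂ (refl , refl)) = ≡-sym cu≡cv

  pushforward-harmonious : c u ≡ c v → IsHarmonious G k c → IsHarmonious H k descend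
  pushforward-harmonious cu≡cv (proper , harmonious) = proper′ , harmonious′
    where
    descend-f : ∀ x → descend (f x) ≡ c x
    descend-f = descend-∘-f cu≡cv

    proper′ : ∀ a b → Edge H a b → descend a ≢ descend b
    proper′ a b e with edgesTo a b e
    ... | x , y , refl , refl , exy =
      λ same → proper x y exy (trans (≡-sym (descend-f x)) (trans same (descend-f y)))

    harmonious′ : ∀ a b a′ b′ → Edge H a b → Edge H a′ b′ →
                  SamePair (descend a) (descend b) (descend a′) (descend b′) → SamePair a b a′ b′
    harmonious′ a b a′ b′ eab ea′b′ same with edgesTo a b eab | edgesTo a′ b′ ea′b′
    ... | x , y , refl , refl , exy | z , t , refl , refl , ezt =
      SamePair-map f (harmonious x y z t exy ezt
        (SamePair-subst (descend-f x) (descend-f y) (descend-f z) (descend-f t) same))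

module _ (G : Graph) {m : ℕ} (f : V G → Fin m) where

  ImageEdge : Fin m → Fin m → Set
  ImageEdge a b = ∃[ x ] ∃[ y ] (f x ≡ a × f y ≡ b × Edge G x y)

  imageEdge? : ∀ a b → Dec (ImageEdge a b)
  imageEdge? a b = any? λ x → any? λ y → (f x ≟ a) ×-dec (f y ≟ b) ×-dec (adj G x y Bool.≟ true)

  ImageEdge-sym : ∀ {a b} → ImageEdge a b → ImageEdge b a
  ImageEdge-sym (x , y , fx≡a , fy≡b , e) = y , x , fy≡b , fx≡a , Edge-sym G e

  imageGraph : (∀ {x y} → f x ≡ f y → ¬ Edge G x y) → Graph
  imageGraph noEdgeCollapsed = record
    { n      = m
    ; adj    = λ a b → does (imageEdge? a b)
    ; sym    = λ a b → does-⇔ (mk⇔ ImageEdge-sym ImageEdge-sym) (imageEdge? a b) (imageEdge? b a)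
    ; irrefl = λ a e → loop (witness (imageEdge? a a) e)
    }
    where
    loop : ∀ {a} → ¬ ImageEdge a a
    loop (x , y , refl , fy≡fx , e) = noEdgeCollapsed (≡-sym fy≡fx) e

merge : ∀ {N} (u v : Fin N) → u ≢ v → Fin N → Fin (pred N)
merge {suc _} u v u≢v x with x ≟ v
... | yes _   = punchOut (≢-sym u≢v)
... | no x≢v  = punchOut (≢-sym x≢v)

merge-glue : ∀ {N} {u v : Fin N} (u≢v : u ≢ v) → merge u v u≢v u ≡ merge u v u≢v v
merge-glue {suc _} {u} {v} u≢v with u ≟ v | v ≟ v
... | yes u≡v | _      = contradiction u≡v u≢v
... | no _    | no v≢v = contradiction refl v≢v
... | no _    | yes _  = punchOut-cong v refl

merge-fibres : ∀ {N} {u v : Fin N} (u≢v : u ≢ v) x y →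
               merge u v u≢v x ≡ merge u v u≢v y → x ≡ y ⊎ SamePair x y u v
merge-fibres {suc _} {u} {v} u≢v x y eq with x ≟ v | y ≟ v
... | yes x≡v | yes y≡v = inj₁ (trans x≡v (≡-sym y≡v))
... | yes x≡v | no y≢v  =
  inj₂ (inj₂ (x≡v , ≡-sym (punchOut-injective (≢-sym u≢v) (≢-sym y≢v) eq)))
... | no x≢v  | yes y≡v =
  inj₂ (inj₁ (punchOut-injective (≢-sym x≢v) (≢-sym u≢v) eq , y≡v))
... | no x≢v  | no y≢v  = inj₁ (punchOut-injective (≢-sym x≢v) (≢-sym y≢v) eq)

merge-surjective : ∀ {N} {u v : Fin N} (u≢v : u ≢ v) a → ∃[ x ] (merge u v u≢v x ≡ a)
merge-surjective {suc _} {u} {v} u≢v a = punchIn v a , merge-punchIn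
  where
  merge-punchIn : merge u v u≢v (punchIn v a) ≡ a
  merge-punchIn with punchIn v a ≟ v
  ... | yes eq = contradiction eq (punchInᵢ≢i v a)
  ... | no _   = trans (punchOut-cong v refl) (punchOut-punchIn v)

module _ (G : Graph) {u v : V G} (u≢v : u ≢ v) (¬uv : ¬ Edge G u v) where

  identify : Graph
  identify = imageGraph G (merge u v u≢v) noEdgeCollapsed
    where
    noEdgeCollapsed : ∀ {x y} → merge u v u≢v x ≡ merge u v u≢v y → ¬ Edge G x y
    noEdgeCollapsed {x} {y} eq e with merge-fibres u≢v x y eq
    ... | inj₁ refl                 = irrefl G x e
    ... | inj₂ (inj₁ (refl , refl)) = ¬uv e
    ... | inj₂ (inj₂ (refl , refl)) = ¬uv (Edge-sym G e)

  identify-isIdentification : IsIdentification G identify u v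
  identify-isIdentification = record
    { distinct    = u≢v
    ; nonadjacent = ¬uv
    ; f           = merge u v u≢v
    ; surj        = merge-surjective u≢v
    ; glue        = merge-glue u≢v
    ; onlyGlue    = merge-fibres u≢v
    ; edgesFrom   = λ x y e → dec-true (imageEdge? G (merge u v u≢v) _ _) (x , y , refl , refl , e)
    ; edgesTo     = λ a b e → witness (imageEdge? G (merge u v u≢v) a b) e
    }

distAtLeast3⇒harmonious-pred : ∀ {G u v} → DistAtLeast G u v 3 → HasHarmonious G (pred (n G))
distAtLeast3⇒harmonious-pred {G} {u} {v} far =
  Step3-pullback (ident u v far (identify-isIdentification G u≢v ¬uv))
                 (id , id-harmonious (identify G u≢v ¬uv))
  where
  u≢v : u ≢ v
  u≢v = distAtLeast3⇒distinct far
  ¬uv : ¬ Edge G u v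
  ¬uv = distAtLeast3⇒nonadjacent far

harmNum≡size⇒diam≤2 : ∀ {G} → IsHarmNum G (n G) → DiamAtMost G 2
harmNum≡size⇒diam≤2 {G} (_ , minimal) u v with walk≤2⊎distAtLeast3 G u v
... | inj₁ shortWalk = shortWalk
... | inj₂ far =
  contradiction (minimal _ (distAtLeast3⇒harmonious-pred far)) (<⇒≱ (pred<size u))

harmNum-identification : ∀ {G H u v k c} → IsIdentification G H u v →
                         IsHarmonious G k c → c u ≡ c v →
                         (∀ j → HasHarmonious G j → k ≤ j) → IsHarmNum H k
harmNum-identification {G} {H} {u} {v} {k} {c} I hc cu≡cv minimal =
  (descend I c , pushforward-harmonious I c cu≡cv hc) ,
  λ j hH → minimal j (Step3-pullback (ident _ _ far I) hH)
  where
  far : DistAtLeast G u v 3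
  far = sameColour⇒distAtLeast3 hc (IsIdentification.distinct I) cu≡cv

harmNum<size⇒Step3 : ∀ {G k} → IsHarmNum G k → k < n G →
                     ∃[ H ] (Step3 G H × n H < n G × IsHarmNum H k)
harmNum<size⇒Step3 {G} ((c , hc) , minimal) k<n with x , y , x<y , cx≡cy ← pigeonhole k<n c =
  let x≢y = <⇒≢ x<y
      ¬xy = λ e → proj₁ hc x y e cx≡cy
      I   = identify-isIdentification G x≢y ¬xy
  in  identify G x≢y ¬xy ,
      ident x y (sameColour⇒distAtLeast3 hc x≢y cx≡cy) I ,
      pred<size x ,
      harmNum-identification I hc cx≡cy minimal

reduceToDiam≤2 : ∀ G → Acc _<_ (n G) → ∀ {k} → IsHarmNum G k →
                 ∃[ H ] (Steps3 G H × n H ≡ k × DiamAtMost H 2)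
reduceToDiam≤2 G (acc smaller) hk with m≤n⇒m<n∨m≡n (harmNum≤size {G} hk)
... | inj₂ refl = G , done , refl , harmNum≡size⇒diam≤2 {G} hk
... | inj₁ k<n with H , first , H<G , hH ← harmNum<size⇒Step3 {G} hk k<n
               with K , steps , sizeK , diamK ← reduceToDiam≤2 H (smaller H<G) hH
  = K , first ∷ steps , sizeK , diamK

Steps3⇒harmNum≤ : ∀ {G H kG kH} → Steps3 G H → IsHarmNum G kG → IsHarmNum H kH → kG ≤ kH
Steps3⇒harmNum≤ steps (_ , minimalG) (hH , _) = minimalG _ (Steps3-pullback steps hH)

mainTheorem3 : (∀ (G : Graph) (k : ℕ) → IsHarmNum G k →
                  ∃[ H ] (Steps3 G H × n H ≡ k × DiamAtMost H 2))
             × (∀ (G H : Graph) → Steps3 G H →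
                  ∀ kG kH → IsHarmNum G kG → IsHarmNum H kH → kG ≤ kH)
mainTheorem3 = (λ G k → reduceToDiam≤2 G (<-wellFounded (n G)))
             , (λ G H steps kG kH → Steps3⇒harmNum≤ steps)
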